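{- For every integer $n\ge0$, \begin{align*} f_n^2&=\sum_{k=0}^{2n}\ \sum_{b=\max(0,\lceil\frac12(3k-2n)\rceil)}^{\lfloor k/2\rfloor}\binom{2n-2k+b}{k-b}\binom{k-b}{b},\\ f_nf_{n+1}&=\sum_{k=0}^{2n+1}\ \sum_{b=\max(0,\lceil\frac12(3k-2n-1)\rceil)}^{\lfloor k/2\rfloor}\binom{2n+1-2k+b}{k-b}\binom{k-b}{b}, \end{align*} where an inner sum whose lower limit exceeds its upper limit is $0$.
   Context: $f_n=F_{n+1}$, where $F_0=0$, $F_1=1$, $F_m=F_{m-1}+F_{m-2}$ are the Fibonacci numbers. -}

module Defs where

open import Data.Nat using (ℕ; zero; suc; _+_; _*_; _∸_; _/_; _≤?_)
open import Data.Nat.Combinatorics using (_C_)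
open import Relation.Nullary using (yes; no)

F : ℕ → ℕ
F zero = 0
F (suc zero) = 1
F (suc (suc m)) = F (suc m) + F m

f : ℕ → ℕ
f n = F (suc n)

sumFrom : ℕ → ℕ → (ℕ → ℕ) → ℕ
sumFrom a zero g = 0
sumFrom a (suc len) g = g a + sumFrom (suc a) len g

rangeSum : ℕ → ℕ → (ℕ → ℕ) → ℕ
rangeSum a b g with a ≤? b
... | yes _ = sumFrom a (suc b ∸ a) g
... | no _ = 0

-- max(0, ⌈(3k - m)/2⌉) computed in ℕ as ⌈(3k ∸ m)/2⌉ = (3k ∸ m + 1) / 2
lowerB : ℕ → ℕ → ℕ
lowerB m k = (3 * k ∸ m + 1) / 2

-- S(m) = Σ_{k=0}^{m} Σ_{b=max(0,⌈(3k-m)/2⌉)}^{⌊k/2⌋} C(m-2k+b, k-b) C(k-b, b)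
-- (within the summation range m + b ≥ 2k, so truncated subtraction is exact)
inner : ℕ → ℕ → ℕ → ℕ
inner m k b = ((m + b ∸ 2 * k) C (k ∸ b)) * ((k ∸ b) C b)

-- Substituting s = k - b and q = b, the double sum S(m) becomes the sum of
-- C(m - 2s - q, s) C(s, q) over all s, q ≥ 0. Pascal's rule in both binomials
-- gives the term-wise recurrence behind S(m + 4) = S(m + 3) + S(m + 1) + S(m)
-- (the generating function is 1 / (1 - x - x³ - x⁴)), and f_n², f_n f_{n+1},
-- interleaved, satisfy the same recurrence with the same initial values 1, 1, 1, 2.
module Submission where

open import Defs
open import Data.Nat
open import Data.Nat.Properties
open import Data.Nat.DivMod using (m≡m%n+[m/n]*n; m%n<n; m/n*n≤m; m/n≤m)
open import Data.Nat.Combinatorics using (_C_; nCk+nC[k+1]≡[n+1]C[k+1]; k>n⇒nCk≡0)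
open import Data.Nat.Tactic.RingSolver using (solve-∀)
open import Data.Product using (_×_; _,_; proj₁; proj₂)
open import Function using (_∘_)
open import Relation.Nullary using (yes; no)
open import Relation.Binary.PropositionalEquality

sumFrom-suc : ∀ a len (g : ℕ → ℕ) → sumFrom (suc a) len g ≡ sumFrom a len (g ∘ suc)
sumFrom-suc a zero      g = refl
sumFrom-suc a (suc len) g = cong (g (suc a) +_) (sumFrom-suc (suc a) len g)

sumFrom-cong : ∀ a len {g h : ℕ → ℕ} → (∀ i → a ≤ i → i < a + len → g i ≡ h i) →
               sumFrom a len g ≡ sumFrom a len h
sumFrom-cong a zero      eq = refl
sumFrom-cong a (suc len) eq = cong₂ _+_ (eq a ≤-refl (m<m+n a z<s))
  (sumFrom-cong (suc a) len λ i a<i i<end → eq i (<⇒≤ a<i) (subst (i <_) (sym (+-suc a len)) i<end))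

sumFrom-zero : ∀ a len {g : ℕ → ℕ} → (∀ i → a ≤ i → i < a + len → g i ≡ 0) → sumFrom a len g ≡ 0
sumFrom-zero a zero      eq = refl
sumFrom-zero a (suc len) eq = cong₂ _+_ (eq a ≤-refl (m<m+n a z<s))
  (sumFrom-zero (suc a) len λ i a<i i<end → eq i (<⇒≤ a<i) (subst (i <_) (sym (+-suc a len)) i<end))

sumFrom-+ : ∀ a len (g h : ℕ → ℕ) → sumFrom a len (λ i → g i + h i) ≡ sumFrom a len g + sumFrom a len h
sumFrom-+ a zero      g h = refl
sumFrom-+ a (suc len) g h = begin
  (g a + h a) + sumFrom (suc a) len (λ i → g i + h i)
    ≡⟨ cong ((g a + h a) +_) (sumFrom-+ (suc a) len g h) ⟩
  (g a + h a) + (sumFrom (suc a) len g + sumFrom (suc a) len h)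
    ≡⟨ +-assoc (g a) (h a) _ ⟩
  g a + (h a + (sumFrom (suc a) len g + sumFrom (suc a) len h))
    ≡⟨ cong (g a +_) (x+[y+z]≡y+[x+z] (h a) (sumFrom (suc a) len g) (sumFrom (suc a) len h)) ⟩
  g a + (sumFrom (suc a) len g + (h a + sumFrom (suc a) len h))
    ≡⟨ +-assoc (g a) _ _ ⟨
  (g a + sumFrom (suc a) len g) + (h a + sumFrom (suc a) len h) ∎
  where
  open ≡-Reasoning
  x+[y+z]≡y+[x+z] : ∀ x y z → x + (y + z) ≡ y + (x + z)
  x+[y+z]≡y+[x+z] = solve-∀

sumFrom-split : ∀ a p r (g : ℕ → ℕ) → sumFrom a (p + r) g ≡ sumFrom a p g + sumFrom (a + p) r g
sumFrom-split a zero    r g = cong (λ a′ → sumFrom a′ r g) (sym (+-identityʳ a))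
sumFrom-split a (suc p) r g = begin
  g a + sumFrom (suc a) (p + r) g
    ≡⟨ cong (g a +_) (sumFrom-split (suc a) p r g) ⟩
  g a + (sumFrom (suc a) p g + sumFrom (suc a + p) r g)
    ≡⟨ +-assoc (g a) _ _ ⟨
  (g a + sumFrom (suc a) p g) + sumFrom (suc a + p) r g
    ≡⟨ cong (λ a′ → (g a + sumFrom (suc a) p g) + sumFrom a′ r g) (sym (+-suc a p)) ⟩
  (g a + sumFrom (suc a) p g) + sumFrom (a + suc p) r g ∎
  where open ≡-Reasoning

sumFrom-snoc : ∀ a len (g : ℕ → ℕ) → sumFrom a (suc len) g ≡ sumFrom a len g + g (a + len)
sumFrom-snoc a len g = begin
  sumFrom a (suc len) g            ≡⟨ cong (λ l → sumFrom a l g) (+-comm 1 len) ⟩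
  sumFrom a (len + 1) g            ≡⟨ sumFrom-split a len 1 g ⟩
  sumFrom a len g + (g (a + len) + 0) ≡⟨ cong (sumFrom a len g +_) (+-identityʳ _) ⟩
  sumFrom a len g + g (a + len)    ∎
  where open ≡-Reasoning

sumFrom-support : ∀ a len L {g : ℕ → ℕ} → a + len ≤ L →
                  (∀ i → i < a → g i ≡ 0) → (∀ i → a + len ≤ i → i < L → g i ≡ 0) →
                  sumFrom 0 L g ≡ sumFrom a len g
sumFrom-support a len L {g} a+len≤L below above = begin
  sumFrom 0 L g
    ≡⟨ cong (λ l → sumFrom 0 l g) (trans (sym (m+[n∸m]≡n a+len≤L)) (+-assoc a len r)) ⟩
  sumFrom 0 (a + (len + r)) g
    ≡⟨ sumFrom-split 0 a (len + r) g ⟩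
  sumFrom 0 a g + sumFrom a (len + r) g
    ≡⟨ cong₂ _+_ (sumFrom-zero 0 a λ i _ i<a → below i i<a) (sumFrom-split a len r g) ⟩
  sumFrom a len g + sumFrom (a + len) r g
    ≡⟨ cong (sumFrom a len g +_) (sumFrom-zero (a + len) r λ i ≤i i<end →
         above i ≤i (subst (i <_) (m+[n∸m]≡n a+len≤L) i<end)) ⟩
  sumFrom a len g + 0
    ≡⟨ +-identityʳ _ ⟩
  sumFrom a len g ∎
  where
  open ≡-Reasoning
  r = L ∸ (a + len)

rangeSum-support : ∀ a c k {g : ℕ → ℕ} → c ≤ k →
                   (∀ i → i < a → i ≤ k → g i ≡ 0) → (∀ i → c < i → i ≤ k → g i ≡ 0) →
                   rangeSum a c g ≡ sumFrom 0 (suc k) g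
rangeSum-support a c k {g} c≤k below above with a ≤? c
... | yes a≤c = sym (sumFrom-support a (suc c ∸ a) (suc k) a+len≤L
      (λ i i<a → below i i<a (≤-trans (<⇒≤ (<-≤-trans i<a a≤c)) c≤k))
      (λ i ≤i i<L → above i (subst (_≤ i) a+len≡suc-c ≤i) (s≤s⁻¹ i<L)))
  where
  a+len≡suc-c : a + (suc c ∸ a) ≡ suc c
  a+len≡suc-c = m+[n∸m]≡n (m≤n⇒m≤1+n a≤c)
  a+len≤L : a + (suc c ∸ a) ≤ suc k
  a+len≤L = subst (_≤ suc k) (sym a+len≡suc-c) (s≤s c≤k)
... | no a≰c = sym (sumFrom-zero 0 (suc k) λ i _ i<L → vanishes i (s≤s⁻¹ i<L))
  where
  vanishes : ∀ i → i ≤ k → g i ≡ 0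
  vanishes i i≤k with i <? a
  ... | yes i<a = below i i<a i≤k
  ... | no i≮a  = above i (<-≤-trans (≰⇒> a≰c) (≮⇒≥ i≮a)) i≤k

shift : (ℕ → ℕ) → ℕ → ℕ
shift g zero    = 0
shift g (suc i) = g i

antidiagonal : (ℕ → ℕ → ℕ) → ℕ → ℕ
antidiagonal F k = sumFrom 0 (suc k) (λ q → F (k ∸ q) q)

antidiagonal-suc : ∀ (F : ℕ → ℕ → ℕ) k →
                   antidiagonal F (suc k) ≡ F 0 (suc k) + antidiagonal (F ∘ suc) k
antidiagonal-suc F k = begin
  sumFrom 0 (suc (suc k)) (λ q → F (suc k ∸ q) q)
    ≡⟨ sumFrom-snoc 0 (suc k) (λ q → F (suc k ∸ q) q) ⟩
  sumFrom 0 (suc k) (λ q → F (suc k ∸ q) q) + F (k ∸ k) (suc k)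
    ≡⟨ cong₂ _+_ (sumFrom-cong 0 (suc k) λ q _ q<1+k →
                    cong (λ s → F s q) (+-∸-assoc 1 (s≤s⁻¹ q<1+k)))
                 (cong (λ s → F s (suc k)) (n∸n≡0 k)) ⟩
  antidiagonal (F ∘ suc) k + F 0 (suc k)
    ≡⟨ +-comm _ (F 0 (suc k)) ⟩
  F 0 (suc k) + antidiagonal (F ∘ suc) k ∎
  where open ≡-Reasoning

antidiagonal-shift : ∀ (F : ℕ → ℕ → ℕ) k → antidiagonal (shift ∘ F) k ≡ shift (antidiagonal F) k
antidiagonal-shift F zero    = refl
antidiagonal-shift F (suc k) = sumFrom-suc 0 (suc k) (λ q → shift (F (suc k ∸ q)) q)

term : ℕ → ℕ → ℕ → ℕ
term m s q = ((m ∸ (s + s + q)) C s) * (s C q)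

row : ℕ → ℕ → ℕ
row m = antidiagonal (term m)

total : ℕ → ℕ
total m = sumFrom 0 (suc m) (row m)

term-vanishes : ∀ {m} s q → m < s + s + s + q → term m s q ≡ 0
term-vanishes {m} zero    (suc q) m<q = refl
term-vanishes {m} (suc s) q       m<3s+q =
  cong (_* (suc s C q)) (k>n⇒nCk≡0 (m<n+o⇒m∸n<o m (suc s + suc s + q)
    (subst (m <_) (reorder (suc s) q) m<3s+q)))
  where
  reorder : ∀ s q → s + s + s + q ≡ s + s + q + s
  reorder = solve-∀

term-vanishes-suc : ∀ {m} s q → m < s + s + s + q → term (3 + m) (suc s) q ≡ 0
term-vanishes-suc {m} s q m<3s+q =
  term-vanishes (suc s) q (subst (3 + m <_) (sym (triple-suc s q)) (s≤s (s≤s (s≤s m<3s+q))))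
  where
  triple-suc : ∀ s q → suc s + suc s + suc s + q ≡ 3 + (s + s + s + q)
  triple-suc = solve-∀

term-suc : ∀ n s q → term (2 + n) (suc s) q ≡ ((n ∸ (s + s + q)) C suc s) * (suc s C q)
term-suc n s q = cong (λ d → ((suc n ∸ d) C suc s) * (suc s C q)) (cong (_+ q) (+-suc s s))

C-suc-shift : ∀ s q → suc s C q ≡ s C q + shift (s C_) q
C-suc-shift s zero    = refl
C-suc-shift s (suc q) = trans (sym (nCk+nC[k+1]≡[n+1]C[k+1] s q)) (+-comm (s C q) (s C suc q))

binomial-step : ∀ A s q → (suc A C suc s) * (suc s C q) ≡
                (A C suc s) * (suc s C q) + (A C s) * (s C q) + (A C s) * shift (s C_) q
binomial-step A s q = begin
  (suc A C suc s) * (suc s C q)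
    ≡⟨ cong (_* (suc s C q)) (sym (nCk+nC[k+1]≡[n+1]C[k+1] A s)) ⟩
  (A C s + A C suc s) * (suc s C q)
    ≡⟨ *-distribʳ-+ (suc s C q) (A C s) (A C suc s) ⟩
  (A C s) * (suc s C q) + (A C suc s) * (suc s C q)
    ≡⟨ cong (_+ (A C suc s) * (suc s C q))
            (trans (cong ((A C s) *_) (C-suc-shift s q)) (*-distribˡ-+ (A C s) (s C q) _)) ⟩
  ((A C s) * (s C q) + (A C s) * shift (s C_) q) + (A C suc s) * (suc s C q)
    ≡⟨ +-comm _ ((A C suc s) * (suc s C q)) ⟩
  (A C suc s) * (suc s C q) + ((A C s) * (s C q) + (A C s) * shift (s C_) q)
    ≡⟨ +-assoc ((A C suc s) * (suc s C q)) _ _ ⟨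
  (A C suc s) * (suc s C q) + (A C s) * (s C q) + (A C s) * shift (s C_) q ∎
  where open ≡-Reasoning

term-recurrence : ∀ m s q →
                  term (4 + m) (suc s) q ≡ term (3 + m) (suc s) q + term (1 + m) s q + shift (term m s) q
term-recurrence m s q with s + s + q ≤? suc m
... | yes d≤1+m = begin
  term (4 + m) (suc s) q
    ≡⟨ term-suc (2 + m) s q ⟩
  ((2 + m ∸ (s + s + q)) C suc s) * (suc s C q)
    ≡⟨ cong (λ top → (top C suc s) * (suc s C q)) (+-∸-assoc 1 d≤1+m) ⟩
  (suc A C suc s) * (suc s C q)
    ≡⟨ binomial-step A s q ⟩
  (A C suc s) * (suc s C q) + (A C s) * (s C q) + (A C s) * shift (s C_) q
    ≡⟨ cong₂ _+_ (cong (_+ (A C s) * (s C q)) (sym (term-suc (1 + m) s q))) (shifted q) ⟩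
  term (3 + m) (suc s) q + term (1 + m) s q + shift (term m s) q ∎
  where
  open ≡-Reasoning
  A = suc m ∸ (s + s + q)
  shifted : ∀ q → ((suc m ∸ (s + s + q)) C s) * shift (s C_) q ≡ shift (term m s) q
  shifted zero    = *-zeroʳ ((suc m ∸ (s + s + 0)) C s)
  shifted (suc q) = cong (λ d → ((suc m ∸ d) C s) * (s C q)) (+-suc (s + s) q)
... | no d≰1+m = trans (term-vanishes-suc s q 1+m<3s+q) (sym (cong₂ _+_
      (cong₂ _+_ (term-vanishes-suc s q (<-trans (n<1+n m) 1+m<3s+q)) (term-vanishes s q 1+m<3s+q))
      (shifted q 1+m<3s+q)))
  where
  1+m<3s+q : suc m < s + s + s + q
  1+m<3s+q = <-≤-trans (≰⇒> d≰1+m) (+-monoˡ-≤ q (m≤m+n (s + s) s))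
  shifted : ∀ q → suc m < s + s + s + q → shift (term m s) q ≡ 0
  shifted zero    _ = refl
  shifted (suc q) lt = term-vanishes s q (s≤s⁻¹ (subst (suc m <_) (+-suc (s + s + s) q) lt))

row-recurrence : ∀ m k → row (4 + m) (suc k) ≡ row (3 + m) (suc k) + row (1 + m) k + shift (row m) k
row-recurrence m k = begin
  row (4 + m) (suc k)
    ≡⟨ antidiagonal-suc (term (4 + m)) k ⟩
  antidiagonal (λ s → term (4 + m) (suc s)) k
    ≡⟨ sumFrom-cong 0 (suc k) (λ q _ _ → term-recurrence m (k ∸ q) q) ⟩
  antidiagonal (λ s q → term (3 + m) (suc s) q + term (1 + m) s q + shift (term m s) q) k
    ≡⟨ sumFrom-+ 0 (suc k) (λ q → term (3 + m) (suc (k ∸ q)) q + term (1 + m) (k ∸ q) q)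
                           (λ q → shift (term m (k ∸ q)) q) ⟩
  antidiagonal (λ s q → term (3 + m) (suc s) q + term (1 + m) s q) k + antidiagonal (shift ∘ term m) k
    ≡⟨ cong₂ _+_ (sumFrom-+ 0 (suc k) (λ q → term (3 + m) (suc (k ∸ q)) q) (λ q → term (1 + m) (k ∸ q) q))
                 (antidiagonal-shift (term m) k) ⟩
  antidiagonal (λ s → term (3 + m) (suc s)) k + row (1 + m) k + shift (row m) k
    ≡⟨ cong (λ x → x + row (1 + m) k + shift (row m) k) (antidiagonal-suc (term (3 + m)) k) ⟨
  row (3 + m) (suc k) + row (1 + m) k + shift (row m) k ∎
  where open ≡-Reasoning

row-vanishes : ∀ {m k} → m < k → row m k ≡ 0
row-vanishes {m} {k} m<k = sumFrom-zero 0 (suc k) λ q _ q<1+k → term-vanishes (k ∸ q) q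
  (<-≤-trans m<k (begin
    k                                     ≡⟨ m∸n+n≡m (s≤s⁻¹ q<1+k) ⟨
    (k ∸ q) + q                           ≤⟨ +-monoˡ-≤ q (m≤n+m (k ∸ q) ((k ∸ q) + (k ∸ q))) ⟩
    (k ∸ q) + (k ∸ q) + (k ∸ q) + q       ∎))
  where open ≤-Reasoning

total-extend : ∀ m L → suc m ≤ L → sumFrom 0 L (row m) ≡ total m
total-extend m L 1+m≤L = sumFrom-support 0 (suc m) L 1+m≤L (λ _ ()) λ k 1+m≤k _ → row-vanishes 1+m≤k

Recurrence : (ℕ → ℕ) → Set
Recurrence a = ∀ m → a (4 + m) ≡ a (3 + m) + a (1 + m) + a m

total-recurrence : Recurrence total
total-recurrence m = begin
  total (4 + m)
    ≡⟨ cong (1 +_) (sumFrom-suc 0 (4 + m) (row (4 + m))) ⟩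
  1 + sumFrom 0 (4 + m) (row (4 + m) ∘ suc)
    ≡⟨ cong (1 +_) (sumFrom-cong 0 (4 + m) λ k _ _ → row-recurrence m k) ⟩
  1 + sumFrom 0 (4 + m) (λ k → row (3 + m) (suc k) + row (1 + m) k + shift (row m) k)
    ≡⟨ cong (1 +_) (trans (sumFrom-+ 0 (4 + m) (λ k → row (3 + m) (suc k) + row (1 + m) k) (shift (row m)))
                          (cong (_+ W) (sumFrom-+ 0 (4 + m) (row (3 + m) ∘ suc) (row (1 + m))))) ⟩
  1 + (X + Y + W)
    ≡⟨ cong (_+ W) (+-assoc 1 X Y) ⟨
  (1 + X) + Y + W
    ≡⟨ cong₂ (λ x w → x + Y + w) 1+X≡total W≡total ⟩
  total (3 + m) + Y + total m
    ≡⟨ cong (λ y → total (3 + m) + y + total m) (total-extend (1 + m) (4 + m) (m≤n+m (2 + m) 2)) ⟩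
  total (3 + m) + total (1 + m) + total m ∎
  where
  open ≡-Reasoning
  X = sumFrom 0 (4 + m) (row (3 + m) ∘ suc)
  Y = sumFrom 0 (4 + m) (row (1 + m))
  W = sumFrom 0 (4 + m) (shift (row m))
  1+X≡total : 1 + X ≡ total (3 + m)
  1+X≡total = trans (cong (1 +_) (sym (sumFrom-suc 0 (4 + m) (row (3 + m)))))
                    (total-extend (3 + m) (5 + m) (n≤1+n (4 + m)))
  W≡total : W ≡ total m
  W≡total = trans (sumFrom-suc 0 (3 + m) (shift (row m))) (total-extend m (3 + m) (m≤n+m (suc m) 2))

FibonacciProducts : (ℕ → ℕ) → ℕ → Set
FibonacciProducts a n = (a (n + n) ≡ f n * f n) × (a (suc (n + n)) ≡ f n * f (suc n))

recurrence⇒fibonacciProducts : ∀ a → Recurrence a → a 0 ≡ 1 → a 1 ≡ 1 → a 2 ≡ 1 → a 3 ≡ 2 →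
                               ∀ n → FibonacciProducts a n
recurrence⇒fibonacciProducts a rec a₀ a₁ a₂ a₃ n = proj₁ (consecutive n)
  where
  double-suc : ∀ n → suc n + suc n ≡ 2 + (n + n)
  double-suc n = cong suc (+-suc n n)

  consecutive : ∀ n → FibonacciProducts a n × FibonacciProducts a (suc n)
  consecutive zero    = (a₀ , a₁) , (a₂ , a₃)
  consecutive (suc n) with consecutive n
  ... | (even₀ , odd₀) , (even₁ , odd₁) = (even₁ , odd₁) , (even₂ , odd₂)
    where
    open ≡-Reasoning
    x = f n
    y = f (suc n)

    square-step : ∀ x y → y * (y + x) + x * y + x * x ≡ (y + x) * (y + x)
    square-step = solve-∀
    product-step : ∀ x y → (y + x) * (y + x) + y * y + x * y ≡ (y + x) * ((y + x) + y)
    product-step = solve-∀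

    double-suc² : suc (suc n) + suc (suc n) ≡ 4 + (n + n)
    double-suc² = trans (double-suc (suc n)) (cong (2 +_) (double-suc n))
    even₁′ : a (2 + (n + n)) ≡ y * y
    even₁′ = trans (cong a (sym (double-suc n))) even₁
    odd₁′ : a (3 + (n + n)) ≡ y * (y + x)
    odd₁′ = trans (cong (a ∘ suc) (sym (double-suc n))) odd₁
    even₂′ : a (4 + (n + n)) ≡ (y + x) * (y + x)
    even₂′ = begin
      a (4 + (n + n))                          ≡⟨ rec (n + n) ⟩
      a (3 + (n + n)) + a (1 + (n + n)) + a (n + n) ≡⟨ cong₂ _+_ (cong₂ _+_ odd₁′ odd₀) even₀ ⟩
      y * (y + x) + x * y + x * x              ≡⟨ square-step x y ⟩
      (y + x) * (y + x)                        ∎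

    even₂ : a (suc (suc n) + suc (suc n)) ≡ f (suc (suc n)) * f (suc (suc n))
    even₂ = trans (cong a double-suc²) even₂′
    odd₂ : a (suc (suc (suc n) + suc (suc n))) ≡ f (suc (suc n)) * f (suc (suc (suc n)))
    odd₂ = begin
      a (suc (suc (suc n) + suc (suc n)))      ≡⟨ cong (a ∘ suc) double-suc² ⟩
      a (4 + (1 + (n + n)))                    ≡⟨ rec (1 + (n + n)) ⟩
      a (4 + (n + n)) + a (2 + (n + n)) + a (1 + (n + n)) ≡⟨ cong₂ _+_ (cong₂ _+_ even₂′ even₁′) odd₀ ⟩
      (y + x) * (y + x) + y * y + x * y        ≡⟨ product-step x y ⟩
      (y + x) * ((y + x) + y)                  ∎

total≡fibonacciProducts : ∀ n → FibonacciProducts total n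
total≡fibonacciProducts = recurrence⇒fibonacciProducts total total-recurrence refl refl refl refl

inner≡term : ∀ m {k b} → b ≤ k → inner m k b ≡ term m (k ∸ b) b
inner≡term m {k} {b} b≤k = begin
  inner m k b
    ≡⟨ cong (λ k′ → inner m k′ b) (sym (m+[n∸m]≡n b≤k)) ⟩
  ((m + b ∸ 2 * (b + s)) C (b + s ∸ b)) * ((b + s ∸ b) C b)
    ≡⟨ cong₂ (λ top s′ → (top C s′) * (s′ C b)) top≡ (m+n∸m≡n b s) ⟩
  term m s b ∎
  where
  open ≡-Reasoning
  s = k ∸ b
  double : ∀ b s → 2 * (b + s) ≡ b + (s + s + b)
  double = solve-∀
  top≡ : m + b ∸ 2 * (b + s) ≡ m ∸ (s + s + b)
  top≡ = begin
    m + b ∸ 2 * (b + s)       ≡⟨ cong₂ _∸_ (+-comm m b) (double b s) ⟩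
    b + m ∸ (b + (s + s + b)) ≡⟨ [m+n]∸[m+o]≡n∸o b m (s + s + b) ⟩
    m ∸ (s + s + b)           ∎

<lowerB⇒b*2+m<3*k : ∀ {m k b} → b < lowerB m k → b * 2 + m < 3 * k
<lowerB⇒b*2+m<3*k {m} {k} {b} b<lowerB = m≤o∸n⇒m+n≤o (suc (b * 2)) (<⇒≤ m<3k) b*2<3k∸m
  where
  b*2<3k∸m : b * 2 < 3 * k ∸ m
  b*2<3k∸m = s≤s⁻¹ (subst (2 + b * 2 ≤_) (+-comm (3 * k ∸ m) 1)
               (≤-trans (*-monoˡ-≤ 2 b<lowerB) (m/n*n≤m (3 * k ∸ m + 1) 2)))
  m<3k : m < 3 * k
  m<3k = m∸n≢0⇒n<m λ 3k∸m≡0 → n≮0 (subst (b * 2 <_) 3k∸m≡0 b*2<3k∸m)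

m/2<n⇒m<n+n : ∀ {m n} → m / 2 < n → m < n + n
m/2<n⇒m<n+n {m} {n} m/2<n = begin-strict
  m                   ≡⟨ m≡m%n+[m/n]*n m 2 ⟩
  m % 2 + (m / 2) * 2 <⟨ +-monoˡ-< ((m / 2) * 2) (m%n<n m 2) ⟩
  suc (m / 2) * 2     ≤⟨ *-monoˡ-≤ 2 m/2<n ⟩
  n * 2               ≡⟨ *-comm n 2 ⟩
  n + (n + 0)         ≡⟨ cong (n +_) (+-identityʳ n) ⟩
  n + n               ∎
  where open ≤-Reasoning

rangeSum-inner≡row : ∀ m k → rangeSum (lowerB m k) (k / 2) (inner m k) ≡ row m k
rangeSum-inner≡row m k = begin
  rangeSum (lowerB m k) (k / 2) (inner m k)
    ≡⟨ rangeSum-support (lowerB m k) (k / 2) k (m/n≤m k 2) below above ⟩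
  sumFrom 0 (suc k) (inner m k)
    ≡⟨ sumFrom-cong 0 (suc k) (λ b _ b<1+k → inner≡term m (s≤s⁻¹ b<1+k)) ⟩
  row m k ∎
  where
  open ≡-Reasoning
  3*[s+b]≡b*2+[s+s+s+b] : ∀ s b → 3 * (s + b) ≡ b * 2 + (s + s + s + b)
  3*[s+b]≡b*2+[s+s+s+b] = solve-∀
  below : ∀ b → b < lowerB m k → b ≤ k → inner m k b ≡ 0
  below b b<lowerB b≤k = trans (inner≡term m b≤k) (term-vanishes (k ∸ b) b
    (+-cancelˡ-< (b * 2) m _ (subst (b * 2 + m <_)
      (trans (cong (3 *_) (sym (m∸n+n≡m b≤k))) (3*[s+b]≡b*2+[s+s+s+b] (k ∸ b) b))
      (<lowerB⇒b*2+m<3*k {m} {k} b<lowerB))))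
  above : ∀ b → k / 2 < b → b ≤ k → inner m k b ≡ 0
  above (suc b) k/2<b _ = trans
    (cong (((m + suc b ∸ 2 * k) C (k ∸ suc b)) *_) (k>n⇒nCk≡0 (m<n+o⇒m∸n<o k (suc b) (m/2<n⇒m<n+n k/2<b))))
    (*-zeroʳ ((m + suc b ∸ 2 * k) C (k ∸ suc b)))

doubleSum≡total : ∀ m → rangeSum 0 m (λ k → rangeSum (lowerB m k) (k / 2) (λ b → inner m k b)) ≡ total m
doubleSum≡total m = sumFrom-cong 0 (suc m) λ k _ _ → rangeSum-inner≡row m k

corollary6p13 : (n : ℕ) →
    (f n * f n ≡ rangeSum 0 (2 * n) (λ k → rangeSum (lowerB (2 * n) k) (k / 2) (λ b → inner (2 * n) k b)))
    × (f n * f (n + 1) ≡ rangeSum 0 (2 * n + 1) (λ k → rangeSum (lowerB (2 * n + 1) k) (k / 2) (λ b → inner (2 * n + 1) k b)))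
corollary6p13 n = sym even , sym odd
  where
  S : ℕ → ℕ
  S m = rangeSum 0 m (λ k → rangeSum (lowerB m k) (k / 2) (λ b → inner m k b))
  2n≡n+n : 2 * n ≡ n + n
  2n≡n+n = cong (n +_) (+-identityʳ n)
  even : S (2 * n) ≡ f n * f n
  even = begin
    S (2 * n)                    ≡⟨ doubleSum≡total (2 * n) ⟩
    total (2 * n)         ≡⟨ cong total 2n≡n+n ⟩
    total (n + n)         ≡⟨ proj₁ (total≡fibonacciProducts n) ⟩
    f n * f n             ∎
    where open ≡-Reasoning
  odd : S (2 * n + 1) ≡ f n * f (n + 1)
  odd = begin
    S (2 * n + 1)                    ≡⟨ doubleSum≡total (2 * n + 1) ⟩
    total (2 * n + 1)     ≡⟨ cong total (trans (+-comm (2 * n) 1) (cong suc 2n≡n+n)) ⟩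
    total (suc (n + n))   ≡⟨ proj₂ (total≡fibonacciProducts n) ⟩
    f n * f (suc n)       ≡⟨ cong (λ j → f n * f j) (+-comm 1 n) ⟩
    f n * f (n + 1)       ∎
    where open ≡-Reasoning
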